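{- Let $m\geq 1$. If there is $n\geq 0$ with $m\le 2^n$ such that $P(T_n,m\times m)=P(T_{n+1},m\times m)$, then $P(T_n,m\times m)=P(T_{n+k},m\times m)$ for all integers $k\geq1$; in particular $P(T_n,m\times m)=P(T,m\times m)$.
   Context: Let $\mathcal{A}=\{\mathtt{A},\dots,\mathtt{P}\}$. The substitution $\mu$ maps each letter to a $2\times2$ block over $\mathcal{A}$ (written (first row / second row)): $\mathtt{A}\mapsto(\mathtt{AF}/\mathtt{GC})$, $\mathtt{B}\mapsto(\mathtt{AF}/\mathtt{HD})$, $\mathtt{C}\mapsto(\mathtt{BE}/\mathtt{GC})$, $\mathtt{D}\mapsto(\mathtt{BE}/\mathtt{HD})$, $\mathtt{E}\mapsto(\mathtt{AN}/\mathtt{GK})$, $\mathtt{F}\mapsto(\mathtt{AN}/\mathtt{HL})$, $\mathtt{G}\mapsto(\mathtt{BM}/\mathtt{GK})$, $\mathtt{H}\mapsto(\mathtt{BM}/\mathtt{HL})$, $\mathtt{I}\mapsto(\mathtt{IF}/\mathtt{OC})$, $\mathtt{J}\mapsto(\mathtt{IF}/\mathtt{PD})$, $\mathtt{K}\mapsto(\mathtt{JE}/\mathtt{OC})$, $\mathtt{L}\mapsto(\mathtt{JE}/\mathtt{PD})$, $\mathtt{M}\mapsto(\mathtt{IN}/\mathtt{OK})$, $\mathtt{N}\mapsto(\mathtt{IN}/\mathtt{PL})$, $\mathtt{O}\mapsto(\mathtt{JM}/\mathtt{OK})$, $\mathtt{P}\mapsto(\mathtt{JM}/\mathtt{PL})$.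 For a matrix $X$ over $\mathcal{A}$, $\mu(X)$ replaces each entry by its $2\times2$ block; $\mu^0=\mathrm{id}$, $\mu^k=\mu^{k-1}\circ\mu$. $T_n:=\mu^n(\mathtt{N})$. For a matrix $X$, $P(X,m\times n)$ denotes the set of all $m\times n$ contiguous submatrices of $X$, and $P(T,m\times n):=\bigcup_{k\ge0}P(T_k,m\times n)$ (the patterns of the limit $T$ of the $T_k$, where $T_k$ is the upper-right block of $T_{k+1}$). -}

module Defs where

open import Data.Nat using (ℕ; zero; suc; _+_; _*_; _≤_)
open import Data.Nat.DivMod using (_/_; _mod_)
open import Data.Fin using (Fin; toℕ)
open import Data.Vec using (Vec; lookup)
open import Data.Product using (∃; ∃-syntax; _×_)
open import Relation.Binary.PropositionalEquality using (_≡_)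
open import Relation.Unary using (Pred)
open import Level using (0ℓ)

data Letter : Set where
  A B C D E F G H I J K L M N O P : Letter

-- 2×2 blocks of the substitution μ, indexed (row, column), row 0 = first row.
blk : Letter → Fin 2 → Fin 2 → Letter
blk x Fin.zero Fin.zero = top₀ x
  where
  top₀ : Letter → Letter
  top₀ A = A ; top₀ B = A ; top₀ C = B ; top₀ D = B
  top₀ E = A ; top₀ F = A ; top₀ G = B ; top₀ H = B
  top₀ I = I ; top₀ J = I ; top₀ K = J ; top₀ L = J
  top₀ M = I ; top₀ N = I ; top₀ O = J ; top₀ P = J
blk x Fin.zero (Fin.suc Fin.zero) = top₁ x
  where
  top₁ : Letter → Letter
  top₁ A = F ; top₁ B = F ; top₁ C = E ; top₁ D = E
  top₁ E = N ; top₁ F = N ; top₁ G = M ; top₁ H = M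
  top₁ I = F ; top₁ J = F ; top₁ K = E ; top₁ L = E
  top₁ M = N ; top₁ N = N ; top₁ O = M ; top₁ P = M
blk x (Fin.suc Fin.zero) Fin.zero = bot₀ x
  where
  bot₀ : Letter → Letter
  bot₀ A = G ; bot₀ B = H ; bot₀ C = G ; bot₀ D = H
  bot₀ E = G ; bot₀ F = H ; bot₀ G = G ; bot₀ H = H
  bot₀ I = O ; bot₀ J = P ; bot₀ K = O ; bot₀ L = P
  bot₀ M = O ; bot₀ N = P ; bot₀ O = O ; bot₀ P = P
blk x (Fin.suc Fin.zero) (Fin.suc Fin.zero) = bot₁ x
  where
  bot₁ : Letter → Letter
  bot₁ A = C ; bot₁ B = D ; bot₁ C = C ; bot₁ D = D
  bot₁ E = K ; bot₁ F = L ; bot₁ G = K ; bot₁ H = L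
  bot₁ I = C ; bot₁ J = D ; bot₁ K = C ; bot₁ L = D
  bot₁ M = K ; bot₁ N = L ; bot₁ O = K ; bot₁ P = L

-- A finite matrix over Letter: dimensions plus entries (row i, column j),
-- only entries with i < rows, j < cols are meaningful.
record Matrix : Set where
  constructor mat
  field
    rows cols : ℕ
    entry : ℕ → ℕ → Letter
open Matrix public

μ : Matrix → Matrix
μ (mat r c f) = mat (2 * r) (2 * c) (λ i j → blk (f (i / 2) (j / 2)) (i mod 2) (j mod 2))

μ^ : ℕ → Matrix → Matrix
μ^ zero X = X
μ^ (suc k) X = μ^ k (μ X)

single : Letter → Matrix
single x = mat 1 1 (λ _ _ → x)

T : ℕ → Matrix
T n = μ^ n (single N)

Pattern : ℕ → Set
Pattern m = Vec (Vec Letter m) m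

Pat : Matrix → (m : ℕ) → Pred (Pattern m) 0ℓ
Pat X m p = ∃[ i ] ∃[ j ] (i + m ≤ rows X × j + m ≤ cols X ×
  (∀ (a b : Fin m) → entry X (i + toℕ a) (j + toℕ b) ≡ lookup (lookup p a) b))

PatT : (m : ℕ) → Pred (Pattern m) 0ℓ
PatT m p = ∃[ k ] Pat (T k) m p

{-# OPTIONS --safe #-}
module Submission where

-- T k sits in T (k + 1) as its upper-right block, so the pattern sets P(T k, m×m) increase with k.
-- Conversely, if X has at least m rows and columns, every m×m window of μ X lies inside the
-- image under μ of an m×m window of X; hence P(X, m×m) ⊆ P(Y, m×m) implies
-- P(μ X, m×m) ⊆ P(μ Y, m×m). Starting from P(T (n + 1)) ⊆ P(T n), this propagates to
-- P(T (k + 1)) ⊆ P(T k) for every k ≥ n, and the pattern sets are constant from n on.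

open import Defs
open import Data.Nat using (ℕ; zero; suc; _+_; _*_; _^_; _≤_; _<_; z≤n; s≤s; s≤s⁻¹)
open import Data.Nat.Properties
open import Data.Nat.DivMod using (_/_; _%_; _mod_; m*n/n≡m; +-distrib-/-∣ˡ; [m+kn]%n≡m%n; m<n*o⇒m/o<n)
open import Data.Nat.Divisibility using (divides)
open import Data.Fin using (Fin; toℕ; fromℕ<)
open import Data.Fin.Properties using (toℕ-fromℕ<; fromℕ<-cong; toℕ<n)
open import Data.Vec using (lookup; tabulate)
open import Data.Vec.Properties using (lookup∘tabulate)
open import Data.Product using (∃-syntax; _×_; _,_; proj₂)
open import Relation.Binary.PropositionalEquality
open import Relation.Unary using (Pred; _⊆_; _≐_)

open ≡-Reasoning

[2*m+n]/2≡m+n/2 : ∀ m n → (2 * m + n) / 2 ≡ m + n / 2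
[2*m+n]/2≡m+n/2 m n = begin
  (2 * m + n) / 2     ≡⟨ +-distrib-/-∣ˡ n (divides m (*-comm 2 m)) ⟩
  2 * m / 2 + n / 2   ≡⟨ cong (λ k → k / 2 + n / 2) (*-comm 2 m) ⟩
  m * 2 / 2 + n / 2   ≡⟨ cong (_+ n / 2) (m*n/n≡m m 2) ⟩
  m + n / 2           ∎

[2*m+n]mod2≡nmod2 : ∀ m n → (2 * m + n) mod 2 ≡ n mod 2
[2*m+n]mod2≡nmod2 m n = fromℕ<-cong _ _ %-eq _ _
  where
  %-eq : (2 * m + n) % 2 ≡ n % 2
  %-eq = begin
    (2 * m + n) % 2   ≡⟨ cong (_% 2) (+-comm (2 * m) n) ⟩
    (n + 2 * m) % 2   ≡⟨ cong (λ k → (n + k) % 2) (*-comm 2 m) ⟩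
    (n + m * 2) % 2   ≡⟨ [m+kn]%n≡m%n n m 2 ⟩
    n % 2             ∎

m<2*n⇒m/2<n : ∀ {m n} → m < 2 * n → m / 2 < n
m<2*n⇒m/2<n {m} {n} m<2n = m<n*o⇒m/o<n (subst (m <_) (*-comm 2 n) m<2n)

m+n≤o⇒2*m+2*n≤2*o : ∀ m n {o} → m + n ≤ o → 2 * m + 2 * n ≤ 2 * o
m+n≤o⇒2*m+2*n≤2*o m n {o} m+n≤o = subst (_≤ 2 * o) (*-distribˡ-+ 2 m n) (*-monoʳ-≤ 2 m+n≤o)

2*m≡m+m : ∀ m → 2 * m ≡ m + m
2*m≡m+m m = cong (m +_) (+-identityʳ m)

split-offset : ∀ {m} R i → 1 ≤ m → i + m ≤ 2 * (m + R) →
  ∃[ i₀ ] ∃[ s ] (i ≡ 2 * i₀ + s × s ≤ m × i₀ ≤ R)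
split-offset {m} zero i _ i+m≤ =
  0 , i , refl , +-cancelʳ-≤ m i m (subst (i + m ≤_) 2*[m+0]≡m+m i+m≤) , z≤n
  where
  2*[m+0]≡m+m : 2 * (m + 0) ≡ m + m
  2*[m+0]≡m+m = trans (cong (2 *_) (+-identityʳ m)) (2*m≡m+m m)
split-offset (suc R) 0 _ _ = 0 , 0 , refl , z≤n , z≤n
split-offset (suc R) 1 1≤m _ = 0 , 1 , refl , 1≤m , z≤n
split-offset {m} (suc R) (suc (suc i)) 1≤m i+m≤
  with split-offset R i 1≤m (s≤s⁻¹ (s≤s⁻¹ (subst (2 + i + m ≤_) 2*[m+1+R]≡2+2*[m+R] i+m≤)))
  where
  2*[m+1+R]≡2+2*[m+R] : 2 * (m + suc R) ≡ 2 + 2 * (m + R)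
  2*[m+1+R]≡2+2*[m+R] = trans (cong (2 *_) (+-suc m R)) (*-suc 2 (m + R))
... | i₀ , s , refl , s≤m , i₀≤R = suc i₀ , s , cong (_+ s) (sym (*-suc 2 i₀)) , s≤m , s≤s i₀≤R

-- A window of length m at offset i of a line of length 2R lies in the doubling of the window at
-- offset i₀ of a line of length R.  Near the end of the line ⌊i/2⌋ is too far right, so i₀ is
-- pushed left and the entry offset s can reach m.
halve-window : ∀ {m R i} → 1 ≤ m → m ≤ R → i + m ≤ 2 * R →
  ∃[ i₀ ] ∃[ s ] (i ≡ 2 * i₀ + s × s + m ≤ 2 * m × i₀ + m ≤ R)
halve-window {m} {R} {i} 1≤m m≤R i+m≤2R with m≤n⇒∃[o]m+o≡n m≤R
... | R′ , refl with split-offset R′ i 1≤m i+m≤2R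
... | i₀ , s , i≡ , s≤m , i₀≤R′ =
  i₀ , s , i≡ , subst (s + m ≤_) (sym (2*m≡m+m m)) (+-monoˡ-≤ m s≤m) ,
  subst (i₀ + m ≤_) (+-comm R′ m) (+-monoˡ-≤ m i₀≤R′)

record SameBlock (h w : ℕ) (X : Matrix) (i j : ℕ) (Y : Matrix) (i′ j′ : ℕ) : Set where
  constructor sameBlock
  field
    same-entry : ∀ a b → a < h → b < w → entry X (i + a) (j + b) ≡ entry Y (i′ + a) (j′ + b)
open SameBlock

SameBlock-shift : ∀ {h w h′ w′ X i j Y i′ j′} s t → SameBlock h w X i j Y i′ j′ →
  s + h′ ≤ h → t + w′ ≤ w → SameBlock h′ w′ X (i + s) (j + t) Y (i′ + s) (j′ + t)
SameBlock-shift {X = X} {i} {j} {Y} {i′} {j′} s t (sameBlock same) s+h′≤h t+w′≤w =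
  sameBlock λ a b a<h′ b<w′ → begin
    entry X (i + s + a) (j + t + b)
      ≡⟨ cong₂ (entry X) (+-assoc i s a) (+-assoc j t b) ⟩
    entry X (i + (s + a)) (j + (t + b))
      ≡⟨ same (s + a) (t + b) (≤-trans (+-monoʳ-< s a<h′) s+h′≤h) (≤-trans (+-monoʳ-< t b<w′) t+w′≤w) ⟩
    entry Y (i′ + (s + a)) (j′ + (t + b))
      ≡⟨ cong₂ (entry Y) (+-assoc i′ s a) (+-assoc j′ t b) ⟨
    entry Y (i′ + s + a) (j′ + t + b)
      ∎

entry-μ : ∀ X i a j b → entry (μ X) (2 * i + a) (2 * j + b) ≡
  blk (entry X (i + a / 2) (j + b / 2)) (a mod 2) (b mod 2)
entry-μ X i a j b =
  trans (cong (λ x → blk x ((2 * i + a) mod 2) ((2 * j + b) mod 2))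
                (cong₂ (entry X) ([2*m+n]/2≡m+n/2 i a) ([2*m+n]/2≡m+n/2 j b)))
        (cong₂ (blk _) ([2*m+n]mod2≡nmod2 i a) ([2*m+n]mod2≡nmod2 j b))

SameBlock-μ : ∀ {h w X i j Y i′ j′} → SameBlock h w X i j Y i′ j′ →
  SameBlock (2 * h) (2 * w) (μ X) (2 * i) (2 * j) (μ Y) (2 * i′) (2 * j′)
SameBlock-μ {X = X} {i} {j} {Y} {i′} {j′} (sameBlock same) = sameBlock λ a b a<2h b<2w → begin
    entry (μ X) (2 * i + a) (2 * j + b)
      ≡⟨ entry-μ X i a j b ⟩
    blk (entry X (i + a / 2) (j + b / 2)) (a mod 2) (b mod 2)
      ≡⟨ cong (λ x → blk x (a mod 2) (b mod 2))
              (same (a / 2) (b / 2) (m<2*n⇒m/2<n a<2h) (m<2*n⇒m/2<n b<2w)) ⟩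
    blk (entry Y (i′ + a / 2) (j′ + b / 2)) (a mod 2) (b mod 2)
      ≡⟨ entry-μ Y i′ a j′ b ⟨
    entry (μ Y) (2 * i′ + a) (2 * j′ + b)
      ∎

Matches : ∀ {m} → Matrix → ℕ → ℕ → Pattern m → Set
Matches X i j p = ∀ a b → entry X (i + toℕ a) (j + toℕ b) ≡ lookup (lookup p a) b

window : (m : ℕ) → Matrix → ℕ → ℕ → Pattern m
window m X i j = tabulate λ a → tabulate λ b → entry X (i + toℕ a) (j + toℕ b)

Matches-window : ∀ m X i j → Matches X i j (window m X i j)
Matches-window m X i j a b =
  sym (trans (cong (λ row → lookup row b) (lookup∘tabulate _ a)) (lookup∘tabulate _ b))

Matches⇒SameBlock : ∀ {m X i j Y i′ j′} {p : Pattern m} →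
  Matches X i j p → Matches Y i′ j′ p → SameBlock m m X i j Y i′ j′
Matches⇒SameBlock {X = X} {i} {j} {Y} {i′} {j′} matchX matchY = sameBlock λ a b a<m b<m →
  let a′ = fromℕ< a<m; b′ = fromℕ< b<m; a≡ = toℕ-fromℕ< a<m; b≡ = toℕ-fromℕ< b<m in begin
  entry X (i + a) (j + b)                 ≡⟨ sym (cong₂ (λ a b → entry X (i + a) (j + b)) a≡ b≡) ⟩
  entry X (i + toℕ a′) (j + toℕ b′)       ≡⟨ matchX a′ b′ ⟩
  _                                       ≡⟨ sym (matchY a′ b′) ⟩
  entry Y (i′ + toℕ a′) (j′ + toℕ b′)     ≡⟨ cong₂ (λ a b → entry Y (i′ + a) (j′ + b)) a≡ b≡ ⟩
  entry Y (i′ + a) (j′ + b)               ∎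

SameBlock-Matches : ∀ {m X i j Y i′ j′} {p : Pattern m} →
  SameBlock m m X i j Y i′ j′ → Matches X i j p → Matches Y i′ j′ p
SameBlock-Matches same match a b =
  trans (sym (same-entry same (toℕ a) (toℕ b) (toℕ<n a) (toℕ<n b))) (match a b)

Pat-⊆⇒SameBlock : ∀ {m X Y i j} → Pat X m ⊆ Pat Y m → i + m ≤ rows X → j + m ≤ cols X →
  ∃[ i′ ] ∃[ j′ ] (i′ + m ≤ rows Y × j′ + m ≤ cols Y × SameBlock m m X i j Y i′ j′)
Pat-⊆⇒SameBlock {m} {X} {Y} {i} {j} X⊆Y i+m≤ j+m≤
  with X⊆Y {window m X i j} (i , j , i+m≤ , j+m≤ , Matches-window m X i j)
... | i′ , j′ , i′+m≤ , j′+m≤ , match =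
  i′ , j′ , i′+m≤ , j′+m≤ , Matches⇒SameBlock {p = window m X i j} (Matches-window m X i j) match

Pat-⊆-μ : ∀ {m X Y} → 1 ≤ m → m ≤ rows X → m ≤ cols X →
  Pat X m ⊆ Pat Y m → Pat (μ X) m ⊆ Pat (μ Y) m
Pat-⊆-μ {m} {X} {Y} 1≤m m≤rows m≤cols X⊆Y {p} (i , j , i+m≤ , j+m≤ , match)
  with halve-window 1≤m m≤rows i+m≤ | halve-window 1≤m m≤cols j+m≤
... | i₀ , s , refl , s+m≤ , i₀+m≤ | j₀ , t , refl , t+m≤ , j₀+m≤
  with Pat-⊆⇒SameBlock {m} {X} {Y} (λ {q} → X⊆Y {q}) i₀+m≤ j₀+m≤
... | i₁ , j₁ , i₁+m≤ , j₁+m≤ , same =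
  2 * i₁ + s , 2 * j₁ + t , bound s+m≤ i₁+m≤ , bound t+m≤ j₁+m≤ ,
  SameBlock-Matches {p = p} (SameBlock-shift s t (SameBlock-μ same) s+m≤ t+m≤) match
  where
  bound : ∀ {s i R} → s + m ≤ 2 * m → i + m ≤ R → 2 * i + s + m ≤ 2 * R
  bound {s} {i} {R} s+m≤ i+m≤R = subst (_≤ 2 * R) (sym (+-assoc (2 * i) s m))
    (≤-trans (+-monoʳ-≤ (2 * i) s+m≤) (m+n≤o⇒2*m+2*n≤2*o i m i+m≤R))

_↪_ : Matrix → Matrix → Set
X ↪ Y = ∃[ r ] ∃[ c ] (r + rows X ≤ rows Y × c + cols X ≤ cols Y ×
  SameBlock (rows X) (cols X) X 0 0 Y r c)

↪-μ : ∀ {X Y} → X ↪ Y → μ X ↪ μ Y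
↪-μ {X} (r , c , r+≤ , c+≤ , same) =
  2 * r , 2 * c , m+n≤o⇒2*m+2*n≤2*o r (rows X) r+≤ , m+n≤o⇒2*m+2*n≤2*o c (cols X) c+≤ ,
  SameBlock-μ same

↪-μ^ : ∀ k {X Y} → X ↪ Y → μ^ k X ↪ μ^ k Y
↪-μ^ zero    X↪Y = X↪Y
↪-μ^ (suc k) X↪Y = ↪-μ^ k (↪-μ X↪Y)

↪⇒Pat-⊆ : ∀ {m X Y} → X ↪ Y → Pat X m ⊆ Pat Y m
↪⇒Pat-⊆ {m} {X} {Y} (r , c , r+≤ , c+≤ , same) {p} (i , j , i+m≤ , j+m≤ , match) =
  r + i , c + j , bound r+≤ i+m≤ , bound c+≤ j+m≤ ,
  SameBlock-Matches {p = p} (SameBlock-shift i j same i+m≤ j+m≤) match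
  where
  bound : ∀ {r i R R′} → r + R ≤ R′ → i + m ≤ R → r + i + m ≤ R′
  bound {r} r+R≤ i+m≤R = ≤-trans (≤-reflexive (+-assoc r _ m)) (≤-trans (+-monoʳ-≤ r i+m≤R) r+R≤)

-- N is the upper-right entry of μ N.
single-N↪μ-single-N : single N ↪ μ (single N)
single-N↪μ-single-N = 0 , 1 , s≤s z≤n , s≤s (s≤s z≤n) ,
  sameBlock λ
  { zero zero _ _ → refl
  ; _ (suc _) _ (s≤s ())
  ; (suc _) _ (s≤s ()) _
  }

μ^-suc : ∀ k X → μ^ (suc k) X ≡ μ (μ^ k X)
μ^-suc zero    X = refl
μ^-suc (suc k) X = μ^-suc k (μ X)

T-suc : ∀ k → T (suc k) ≡ μ (T k)
T-suc k = μ^-suc k (single N)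

rows-T : ∀ k → rows (T k) ≡ 2 ^ k
rows-T zero    = refl
rows-T (suc k) = trans (cong rows (T-suc k)) (cong (2 *_) (rows-T k))

cols-T : ∀ k → cols (T k) ≡ 2 ^ k
cols-T zero    = refl
cols-T (suc k) = trans (cong cols (T-suc k)) (cong (2 *_) (cols-T k))

Pat-T-mono : ∀ m k → Pat (T k) m ⊆ Pat (T (suc k)) m
Pat-T-mono m k {p} = ↪⇒Pat-⊆ {m} {T k} {T (suc k)} (↪-μ^ k single-N↪μ-single-N) {p}

Pat-T-antimono-step : ∀ {m k} → 1 ≤ m → m ≤ 2 ^ suc k →
  Pat (T (suc k)) m ⊆ Pat (T k) m → Pat (T (suc (suc k))) m ⊆ Pat (T (suc k)) m
Pat-T-antimono-step {m} {k} 1≤m m≤2^[1+k] T₁⊆T₀ {p} =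
  subst₂ (λ X Y → Pat X m p → Pat Y m p) (sym (T-suc (suc k))) (sym (T-suc k))
    (Pat-⊆-μ {m} {T (suc k)} {T k} 1≤m (subst (m ≤_) (sym (rows-T (suc k))) m≤2^[1+k])
       (subst (m ≤_) (sym (cols-T (suc k))) m≤2^[1+k]) (λ {q} → T₁⊆T₀ {q}) {p})

module _ {a ℓ} {A : Set a} {S : ℕ → Pred A ℓ} where

  ascending-⊆ : (∀ k → S k ⊆ S (suc k)) → ∀ j k → S k ⊆ S (j + k)
  ascending-⊆ S-mono zero    k x = x
  ascending-⊆ S-mono (suc j) k x = S-mono (j + k) (ascending-⊆ S-mono j k x)

  descending-⊆ : (∀ k → S (suc k) ⊆ S k) → ∀ k → S k ⊆ S 0
  descending-⊆ S-anti zero    x = x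
  descending-⊆ S-anti (suc k) x = descending-⊆ S-anti k (S-anti k x)

lemma2 : (m n : ℕ) → 1 ≤ m → m ≤ 2 ^ n →
    Pat (T n) m ≐ Pat (T (suc n)) m →
    ((k : ℕ) → 1 ≤ k → Pat (T n) m ≐ Pat (T (n + k)) m) × (Pat (T n) m ≐ PatT m)
lemma2 m n 1≤m m≤2^n (_ , Tₙ₊₁⊆Tₙ) =
  (λ k _ → constant k) ,
  (λ x → n , x) , λ {p} (k , x) → proj₂ (constant k) {p} (ascending-⊆ (Pat-T-mono m) n k {p} x)
  where
  shrinking : ∀ k → Pat (T (suc k + n)) m ⊆ Pat (T (k + n)) m
  shrinking zero    {p} = Tₙ₊₁⊆Tₙ {p}
  shrinking (suc k) {p} =
    Pat-T-antimono-step {m} {k + n} 1≤m (≤-trans m≤2^n (^-monoʳ-≤ 2 (m≤n+m n (suc k))))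
      (λ {q} → shrinking k {q}) {p}

  constant : ∀ k → Pat (T n) m ≐ Pat (T (n + k)) m
  constant k rewrite +-comm n k =
    (λ {p} → ascending-⊆ (Pat-T-mono m) k n {p}) ,
    (λ {p} → descending-⊆ shrinking k {p})
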